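{- Let $\mathsf{M}^* = \langle I, \{S_{\Phi}\}_{\Phi \subseteq \mathsf{At}}, (r^{\Phi}_{\Psi})_{\Psi \subseteq \Phi \subseteq \mathsf{At}}, (\Lambda^*_i)_{i \in I}, (\alpha_i)_{i \in I}, v \rangle$ be an implicit knowledge-based HMS model and let $\Pi^*_i$ be the derived explicit possibility correspondence. For any individual $i \in I$, if $\alpha_i$ satisfies properties O., I., II., III., and IV., then $\Pi^*_i$ satisfies Confinement, Generalized Reflexivity, Stationarity, Projections Preserve Ignorance, and Projections Preserve Knowledge.
   Context: Fix a nonempty set $\mathsf{At}$ of atomic formulas. The lattice of spaces: for each $\Phi \subseteq \mathsf{At}$ a nonempty state space $S_\Phi$, pairwise disjoint, ordered by $S_\Psi \preceq S_\Phi$ iff $\Psi \subseteq \Phi$; $\Omega := \bigcup_\Phi S_\Phi$; surjections $r^\Phi_\Psi : S_\Phi \to S_\Psi$ for $\Psi \subseteq \Phi$ with $r^\Phi_\Phi$ the identity and $r^\Phi_\Upsilon = r^\Psi_\Upsilon \circ r^\Phi_\Psi$ for $\Upsilon \subseteq \Psi \subseteq \Phi$. Notation: $\omega_\Psi := r^\Phi_\Psi(\omega)$ for $\omega \in S_\Phi$; $D_\Psi := r^\Phi_\Psi(D)$ for $D \subseteq S_\Phi$, and for a space $S = S_\Psi$, $D_S := D_\Psi$; $S_\omega$ is the space containing $\omega$; $D^{\uparrow} := \bigcup_{\Phi \subseteq \Psi \subseteq \mathsf{At}} (r^\Psi_\Phi)^{ -1}(D)$ for $D \subseteq S_\Phi$.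 An implicit knowledge-based HMS model $\langle I, \{S_\Phi\}, (r^\Phi_\Psi), (\Lambda^*_i)_{i\in I}, (\alpha_i)_{i\in I}, v\rangle$ has a nonempty set $I$ of individuals, the lattice above, maps $\Lambda^*_i : \Omega \to 2^\Omega \setminus \{\emptyset\}$ satisfying Reflexivity ($\omega \in \Lambda^*_i(\omega)$), Stationarity ($\omega' \in \Lambda^*_i(\omega) \Rightarrow \Lambda^*_i(\omega') = \Lambda^*_i(\omega)$) and Projections Preserve Implicit Knowledge (if $\omega \in S_\Phi$ then $\Lambda^*_i(\omega)_\Psi = \Lambda^*_i(\omega_\Psi)$ for all $\Psi \subseteq \Phi$); awareness functions $\alpha_i : \Omega \to \{S_\Phi\}_{\Phi \subseteq \mathsf{At}}$; and a valuation $v$ from atoms to events. Properties of $\alpha_i$: O. if $\omega \in S_\Phi$ then $\alpha_i(\omega) \preceq S_\Phi$; I. if $\omega' \in \Lambda^*_i(\omega)$ then $\alpha_i(\omega') = \alpha_i(\omega)$; II. if $\omega \in S_\Phi$ and $S_\Psi \preceq \alpha_i(\omega)$ then $\alpha_i(\omega_\Psi) = S_\Psi$; III. if $\omega \in S_\Phi$ and $\alpha_i(\omega) \preceq S_\Psi \preceq S_\Phi$ then $\alpha_i(\omega_\Psi) = \alpha_i(\omega)$; IV. if $\omega \in S_\Phi$ and $\Psi \subseteq \Phi$ then $\alpha_i(\omega) \succeq \alpha_i(\omega_\Psi)$. The derived explicit possibility correspondence $\Pi^*_i : \Omega \to 2^\Omega$ is defined by $\Pi^*_i(\omega_\Phi)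 := \Lambda^*_i(\omega)_{\alpha_i(\omega_\Phi)}$ for all $\omega \in \Omega$ and $\Phi$ with $S_\Phi \preceq S_\omega$. For a correspondence $\Pi$ write $\Pi^\uparrow(\omega) := (\Pi(\omega))^\uparrow$. The five properties, for $\Pi = \Pi^*_i$: Confinement (if $\omega \in S_\Phi$ then $\Pi(\omega) \subseteq S_\Psi$ for some $\Psi \subseteq \Phi$); Generalized Reflexivity ($\omega \in \Pi^\uparrow(\omega)$ for all $\omega$); Stationarity ($\omega' \in \Pi(\omega) \Rightarrow \Pi(\omega') = \Pi(\omega)$); Projections Preserve Ignorance ($\omega \in S_\Phi$, $\Psi \subseteq \Phi \Rightarrow \Pi^\uparrow(\omega) \subseteq \Pi^\uparrow(\omega_\Psi)$); Projections Preserve Knowledge ($\Upsilon \subseteq \Psi \subseteq \Phi$, $\omega \in S_\Phi$, $\Pi(\omega) \subseteq S_\Psi \Rightarrow (\Pi(\omega))_\Upsilon = \Pi(\omega_\Upsilon)$). -}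

module Defs where

open import Level using (0ℓ)
open import Data.Product using (Σ; ∃; _×_; _,_)
open import Relation.Unary using (Pred; _∈_; _⊆_; _≐_)
open import Relation.Binary.PropositionalEquality using (_≡_)

-- A subset Φ ⊆ At of atomic formulas.  Two subsets are "the same" when
-- they are extensionally equal (_≐_); the lattice order S_Ψ ⪯ S_Φ is Ψ ⊆ Φ.
Sub : Set → Set₁
Sub At = Pred At 0ℓ

-- The disjoint union Ω = ⋃_Φ S_Φ is a single type
-- together with lev : Ω → Sub At, where ω ∈ S_Φ iff lev ω ≐ Φ.
-- proj Ψ ω is r^{lev ω}_Ψ(ω) = ω_Ψ (only meaningful when Ψ ⊆ lev ω).
record Lattice (At : Set) : Set₁ where
  field
    Ω    : Set
    lev  : Ω → Sub At
    proj : Sub At → Ω → Ω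
    space-nonempty : (Φ : Sub At) → ∃ λ ω → lev ω ≐ Φ
    proj-lev  : (ω : Ω) (Ψ : Sub At) → Ψ ⊆ lev ω → lev (proj Ψ ω) ≐ Ψ
    -- r depends only on the subset Ψ, not on its presentation
    proj-resp : (ω : Ω) (Ψ Ψ′ : Sub At) → Ψ ≐ Ψ′ → proj Ψ ω ≡ proj Ψ′ ω
    proj-id   : (ω : Ω) → proj (lev ω) ω ≡ ω
    proj-comp : (ω : Ω) (Ψ Υ : Sub At) → Υ ⊆ Ψ → Ψ ⊆ lev ω →
                proj Υ (proj Ψ ω) ≡ proj Υ ω
    proj-surj : (Φ Ψ : Sub At) → Ψ ⊆ Φ → (ω′ : Ω) → lev ω′ ≐ Ψ →
                ∃ λ ω → (lev ω ≐ Φ) × (proj Ψ ω ≡ ω′)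

  S : Sub At → Pred Ω 0ℓ
  S Φ ω = lev ω ≐ Φ

  _↓_ : Pred Ω 0ℓ → Sub At → Pred Ω 0ℓ
  (D ↓ Ψ) ω′ = ∃ λ ω → (ω ∈ D) × (proj Ψ ω ≡ ω′)

  -- D^↑ for D contained in a single space S_Φ:
  -- all ω′ in spaces above S_Φ whose projection to Φ lies in D.
  _↑ : Pred Ω 0ℓ → Pred Ω 0ℓ
  (D ↑) ω′ = ∃ λ ω → (ω ∈ D) × (lev ω ⊆ lev ω′) × (proj (lev ω) ω′ ≡ ω)

record HMSModel (At : Set) : Set₂ where
  field
    lattice : Lattice At
  open Lattice lattice public
  field
    I   : Set
    I-nonempty : I
    Λ*  : I → Ω → Pred Ω 0ℓ
    Λ*-nonempty : (i : I) (ω : Ω) → ∃ λ ω′ → ω′ ∈ Λ* i ω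
    Λ*-confined : (i : I) (ω ω′ : Ω) → ω′ ∈ Λ* i ω → lev ω′ ≐ lev ω
    Λ*-refl     : (i : I) (ω : Ω) → ω ∈ Λ* i ω
    Λ*-stat     : (i : I) (ω ω′ : Ω) → ω′ ∈ Λ* i ω → Λ* i ω′ ≐ Λ* i ω
    Λ*-ppik     : (i : I) (ω : Ω) (Ψ : Sub At) → Ψ ⊆ lev ω →
                  (Λ* i ω ↓ Ψ) ≐ Λ* i (proj Ψ ω)
    -- awareness functions (value = index of the space α_i(ω))
    α   : I → Ω → Sub At
    -- valuation (irrelevant for the result)
    v   : At → Pred Ω 0ℓ

module _ {At : Set} (M : HMSModel At) where
  open HMSModel M

  PropO : I → Set
  PropO i = (ω : Ω) → α i ω ⊆ lev ω

  PropI : I → Set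
  PropI i = (ω ω′ : Ω) → ω′ ∈ Λ* i ω → α i ω′ ≐ α i ω

  PropII : I → Set₁
  PropII i = (ω : Ω) (Ψ : Sub At) → Ψ ⊆ α i ω → α i (proj Ψ ω) ≐ Ψ

  PropIII : I → Set₁
  PropIII i = (ω : Ω) (Ψ : Sub At) → α i ω ⊆ Ψ → Ψ ⊆ lev ω →
              α i (proj Ψ ω) ≐ α i ω

  PropIV : I → Set₁
  PropIV i = (ω : Ω) (Ψ : Sub At) → Ψ ⊆ lev ω → α i (proj Ψ ω) ⊆ α i ω

  -- derived explicit possibility correspondence:
  -- Π*_i(ω_Φ) := Λ*_i(ω)_{α_i(ω_Φ)}, taken with ω_Φ = ω itself.
  Π* : I → Ω → Pred Ω 0ℓ
  Π* i ω = Λ* i ω ↓ α i ω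

module _ {At : Set} (L : Lattice At) where
  open Lattice L

  Confinement : (Ω → Pred Ω 0ℓ) → Set₁
  Confinement Π = (ω : Ω) → Σ (Sub At) λ Ψ → (Ψ ⊆ lev ω) × (Π ω ⊆ S Ψ)

  GeneralizedReflexivity : (Ω → Pred Ω 0ℓ) → Set
  GeneralizedReflexivity Π = (ω : Ω) → ω ∈ (Π ω ↑)

  Stationarity : (Ω → Pred Ω 0ℓ) → Set
  Stationarity Π = (ω ω′ : Ω) → ω′ ∈ Π ω → Π ω′ ≐ Π ω

  ProjPreserveIgnorance : (Ω → Pred Ω 0ℓ) → Set₁
  ProjPreserveIgnorance Π = (ω : Ω) (Ψ : Sub At) → Ψ ⊆ lev ω →
                            (Π ω ↑) ⊆ (Π (proj Ψ ω) ↑)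

  ProjPreserveKnowledge : (Ω → Pred Ω 0ℓ) → Set₁
  ProjPreserveKnowledge Π = (ω : Ω) (Ψ Υ : Sub At) → Υ ⊆ Ψ → Ψ ⊆ lev ω →
                            Π ω ⊆ S Ψ → (Π ω ↓ Υ) ≐ Π (proj Υ ω)

{-# OPTIONS --safe #-}
-- Every explicit knowledge set Π*_i(ω) is the projection Λ*_i(ω)_{α_i(ω)} of a
-- partition cell, and by Projections Preserve Implicit Knowledge the explicit
-- knowledge set at a projection ω_Ψ is again a projection of the cell of ω
-- itself: Π*_i(ω_Ψ) = Λ*_i(ω)_{α_i(ω_Ψ)}.  Since iterated projections compose,
-- all five properties reduce to comparing projections of one cell to two
-- levels, which the awareness properties O, I, II and IV relate.
module Submission where

open import Level using (0ℓ)
open import Data.Product using (_×_; _,_; proj₁; proj₂)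
open import Relation.Unary using (Pred; _∈_; _⊆_; _≐_)
open import Relation.Unary.Properties using (≐-sym)
open import Relation.Unary.Relation.Binary.Equality using (≐-setoid)
open import Relation.Binary.PropositionalEquality using (refl; sym; trans; cong)
import Relation.Binary.Reasoning.Setoid as SetoidReasoning

open import Defs

module LatticeProperties {At : Set} (L : Lattice At) where
  open Lattice L

  Above : Sub At → Pred Ω 0ℓ
  Above Ψ ω = Ψ ⊆ lev ω

  ↓-cong : {D D′ : Pred Ω 0ℓ} → D ≐ D′ → (Ψ : Sub At) → (D ↓ Ψ) ≐ (D′ ↓ Ψ)
  ↓-cong (D⊆D′ , D′⊆D) Ψ =
      (λ { (x , x∈D , eq) → x , D⊆D′ x∈D , eq })
    , (λ { (x , x∈D′ , eq) → x , D′⊆D x∈D′ , eq })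

  ↓-resp-≐ : (D : Pred Ω 0ℓ) {Ψ Ψ′ : Sub At} → Ψ ≐ Ψ′ → (D ↓ Ψ) ≐ (D ↓ Ψ′)
  ↓-resp-≐ D {Ψ} {Ψ′} Ψ≐Ψ′ =
      (λ { (x , x∈D , refl) → x , x∈D , sym (proj-resp x Ψ Ψ′ Ψ≐Ψ′) })
    , (λ { (x , x∈D , refl) → x , x∈D , proj-resp x Ψ Ψ′ Ψ≐Ψ′ })

  ↓-confined : {D : Pred Ω 0ℓ} {Ψ : Sub At} → D ⊆ Above Ψ → (D ↓ Ψ) ⊆ S Ψ
  ↓-confined {Ψ = Ψ} D⊆Ψ (x , x∈D , refl) = proj-lev x Ψ (D⊆Ψ x∈D)

  ↓-↓ : {D : Pred Ω 0ℓ} {Ψ Υ : Sub At} → D ⊆ Above Ψ → Υ ⊆ Ψ →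
        ((D ↓ Ψ) ↓ Υ) ≐ (D ↓ Υ)
  ↓-↓ {Ψ = Ψ} {Υ} D⊆Ψ Υ⊆Ψ =
      (λ { (_ , (x , x∈D , refl) , refl) →
             x , x∈D , sym (proj-comp x Ψ Υ Υ⊆Ψ (D⊆Ψ x∈D)) })
    , (λ { (x , x∈D , refl) →
             proj Ψ x , (x , x∈D , refl) , proj-comp x Ψ Υ Υ⊆Ψ (D⊆Ψ x∈D) })

  proj∈⇒∈↑ : {D : Pred Ω 0ℓ} {Ψ : Sub At} {ω : Ω} → Ψ ⊆ lev ω →
             proj Ψ ω ∈ D → ω ∈ (D ↑)
  proj∈⇒∈↑ {Ψ = Ψ} {ω} Ψ⊆ω ωΨ∈D =
    proj Ψ ω , ωΨ∈D , (λ a∈ωΨ → Ψ⊆ω (proj₁ levωΨ a∈ωΨ))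
    , proj-resp ω _ Ψ levωΨ
    where
      levωΨ : lev (proj Ψ ω) ≐ Ψ
      levωΨ = proj-lev ω Ψ Ψ⊆ω

  ↑-mono : {D D′ : Pred Ω 0ℓ} → D ⊆ D′ → (D ↑) ⊆ (D′ ↑)
  ↑-mono D⊆D′ (y , y∈D , rest) = y , D⊆D′ y∈D , rest

  ↑⊆↓↑ : {D : Pred Ω 0ℓ} {Υ : Sub At} → D ⊆ Above Υ → (D ↑) ⊆ ((D ↓ Υ) ↑)
  ↑⊆↓↑ {Υ = Υ} D⊆Υ {ω} (y , y∈D , y⊆ω , ωy≡y) =
    proj∈⇒∈↑ (λ a∈Υ → y⊆ω (D⊆Υ y∈D a∈Υ))
      (y , y∈D , trans (cong (proj Υ) (sym ωy≡y))
                       (proj-comp ω (lev y) Υ (D⊆Υ y∈D) y⊆ω))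

module ExplicitKnowledge {At : Set} (M : HMSModel At) (i : HMSModel.I M)
                         (pO : PropO M i) where
  open HMSModel M
  open LatticeProperties lattice
  open SetoidReasoning (≐-setoid Ω 0ℓ)

  Π : Ω → Pred Ω 0ℓ
  Π = Π* M i

  Λ*-above : {ω : Ω} {Ψ : Sub At} → Ψ ⊆ lev ω → Λ* i ω ⊆ Above Ψ
  Λ*-above {ω} Ψ⊆ω {x} x∈Λω a∈Ψ =
    proj₂ (Λ*-confined i ω x x∈Λω) (Ψ⊆ω a∈Ψ)

  Λ*-above-α : (ω : Ω) → Λ* i ω ⊆ Above (α i ω)
  Λ*-above-α ω = Λ*-above (pO ω)

  Π*-confined : (ω : Ω) → Π ω ⊆ S (α i ω)
  Π*-confined ω = ↓-confined (Λ*-above-α ω)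

  Π*-proj : (ω : Ω) (Ψ : Sub At) → Ψ ⊆ lev ω →
            Π (proj Ψ ω) ≐ (Λ* i ω ↓ α i (proj Ψ ω))
  Π*-proj ω Ψ Ψ⊆ω = begin
    Λ* i (proj Ψ ω) ↓ B  ≈⟨ ↓-cong (≐-sym (Λ*-ppik i ω Ψ Ψ⊆ω)) B ⟩
    (Λ* i ω ↓ Ψ) ↓ B     ≈⟨ ↓-↓ (Λ*-above Ψ⊆ω) B⊆Ψ ⟩
    Λ* i ω ↓ B           ∎
    where
      B : Sub At
      B = α i (proj Ψ ω)
      B⊆Ψ : B ⊆ Ψ
      B⊆Ψ a∈B = proj₁ (proj-lev ω Ψ Ψ⊆ω) (pO (proj Ψ ω) a∈B)

  Π*-confinement : Confinement lattice Π
  Π*-confinement ω = α i ω , pO ω , Π*-confined ω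

  Π*-generalizedReflexivity : GeneralizedReflexivity lattice Π
  Π*-generalizedReflexivity ω = proj∈⇒∈↑ (pO ω) (ω , Λ*-refl i ω , refl)

  Π*-stationarity : PropI M i → PropII M i → Stationarity lattice Π
  Π*-stationarity pI pII ω _ (x , x∈Λω , refl) = begin
    Π (proj (α i ω) x)             ≈⟨ Π*-proj x (α i ω) (Λ*-above-α ω x∈Λω) ⟩
    Λ* i x ↓ α i (proj (α i ω) x)  ≈⟨ ↓-resp-≐ (Λ* i x) (pII x (α i ω) α⊆αx) ⟩
    Λ* i x ↓ α i ω                 ≈⟨ ↓-cong (Λ*-stat i ω x x∈Λω) (α i ω) ⟩
    Λ* i ω ↓ α i ω                 ∎
    where
      α⊆αx : α i ω ⊆ α i x
      α⊆αx = proj₂ (pI ω x x∈Λω)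

  Π*-projPreserveIgnorance : PropIV M i → ProjPreserveIgnorance lattice Π
  Π*-projPreserveIgnorance pIV ω Ψ Ψ⊆ω ω″∈Πω↑ =
    ↑-mono (proj₁ Πω↓B≐ΠωΨ) (↑⊆↓↑ Πω⊆B ω″∈Πω↑)
    where
      B : Sub At
      B = α i (proj Ψ ω)
      B⊆α : B ⊆ α i ω
      B⊆α = pIV ω Ψ Ψ⊆ω
      Πω⊆B : Π ω ⊆ Above B
      Πω⊆B y∈Πω a∈B = proj₂ (Π*-confined ω y∈Πω) (B⊆α a∈B)
      Πω↓B≐ΠωΨ : (Π ω ↓ B) ≐ Π (proj Ψ ω)
      Πω↓B≐ΠωΨ = begin
        (Λ* i ω ↓ α i ω) ↓ B  ≈⟨ ↓-↓ (Λ*-above-α ω) B⊆α ⟩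
        Λ* i ω ↓ B            ≈⟨ ≐-sym (Π*-proj ω Ψ Ψ⊆ω) ⟩
        Π (proj Ψ ω)          ∎

  Π*-projPreserveKnowledge : PropII M i → ProjPreserveKnowledge lattice Π
  Π*-projPreserveKnowledge pII ω Ψ Υ Υ⊆Ψ Ψ⊆ω Πω⊆Ψ = begin
    (Λ* i ω ↓ α i ω) ↓ Υ  ≈⟨ ↓-↓ (Λ*-above-α ω) Υ⊆α ⟩
    Λ* i ω ↓ Υ            ≈⟨ ↓-resp-≐ (Λ* i ω) (≐-sym (pII ω Υ Υ⊆α)) ⟩
    Λ* i ω ↓ α i ωΥ       ≈⟨ ≐-sym (Π*-proj ω Υ (λ a∈Υ → Ψ⊆ω (Υ⊆Ψ a∈Υ))) ⟩
    Π ωΥ                  ∎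
    where
      ωΥ : Ω
      ωΥ = proj Υ ω
      -- the level Ψ of Π ω is read off its element ω_{α ω}
      ωα∈Πω : proj (α i ω) ω ∈ Π ω
      ωα∈Πω = ω , Λ*-refl i ω , refl
      Υ⊆α : Υ ⊆ α i ω
      Υ⊆α a∈Υ =
        proj₁ (Π*-confined ω ωα∈Πω) (proj₂ (Πω⊆Ψ ωα∈Πω) (Υ⊆Ψ a∈Υ))

lemma9 : {At : Set} → At → (M : HMSModel At) → (i : HMSModel.I M) →
    PropO M i → PropI M i → PropII M i → PropIII M i → PropIV M i →
    Confinement (HMSModel.lattice M) (Π* M i)
    × GeneralizedReflexivity (HMSModel.lattice M) (Π* M i)
    × Stationarity (HMSModel.lattice M) (Π* M i)
    × ProjPreserveIgnorance (HMSModel.lattice M) (Π* M i)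
    × ProjPreserveKnowledge (HMSModel.lattice M) (Π* M i)
lemma9 _ M i pO pI pII _ pIV =
    Π*-confinement
  , Π*-generalizedReflexivity
  , Π*-stationarity pI pII
  , Π*-projPreserveIgnorance pIV
  , Π*-projPreserveKnowledge pII
  where open ExplicitKnowledge M i pO
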